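{- Let $G$ be a graph with an edge-colouring $c$. (i) Let $C= \{c_1, \dots, c_{\ell} \}$ be a set of $\ell$ distinct colours. Let $W = \{x_i,y_i, z_i, w : i \in [\ell] \}$ be a set of $3\ell+1$ distinct vertices such that $x_iy_i$ and $z_iw$ are edges with $c(x_iy_i) = c_i= c(z_iw)$ for all $i \in [\ell]$. Then $W$ is a $(C,\ell+1)$-adapter. (ii) Let $\ell_1, \ldots, \ell_p \in \mathbb{N}$ and let $C_1, \ldots, C_{p}$ be pairwise disjoint colour sets. Suppose that $W_j$ is a $(C_j, \ell_j)$-adapter for all $j \in [p]$ and that $W_1, \ldots, W_p$ are pairwise disjoint. Then $\bigcup_{j=1}^{p} W_j$ is a $(\bigcup_{j=1}^{p} C_j, \max_{ j \in [p] } \ell_j )$-adapter. (iii) Let $C$ be a colour set and suppose that $W$ is a $(C, \ell)$-adapter. Suppose that $x,y,z \in V(G) \setminus W$ are distinct and $w \in W$ are such that $xy, zw \in E(G)$ and $c(xy) = c(zw) \notin C$. Then $W \cup \{x,y,z\}$ is a $( C \cup \{c(xy) \}, \ell+1 )$-adapter.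
   Context: $[\ell]=\{1,\dots,\ell\}$. A matching is rainbow if its edges have distinct colours; $c(M)$ is the set of colours on a matching $M$, and $G[W]$ is the subgraph induced on $W$. Given $\ell \in \mathbb{N}$ and a set $C$ of colours, a vertex subset $W \subseteq V(G)$ is a $(C,\ell)$-adapter if there exist (not necessarily edge-disjoint) rainbow matchings $M_1, \ldots, M_{\ell}$ in $G[W]$ such that $c(M_i) = C$ for all $i \in [\ell]$, and for every $w \in W$ there exists $i \in [\ell]$ with $w \notin V(M_i)$. -}

module Defs where

open import Data.Nat using (ℕ; zero; suc; _⊔_)
open import Data.Fin using (Fin; zero; suc)
open import Data.Product using (_×_; _,_; Σ-syntax)
open import Data.List using (List; []; _∷_; map; concatMap)
open import Data.List.Membership.Propositional using (_∈_)
open import Data.List.Relation.Unary.All using (All)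
open import Data.List.Relation.Unary.Unique.Propositional using (Unique)
open import Relation.Binary.PropositionalEquality using (_≡_; _≢_)
open import Relation.Nullary using (¬_)
open import Relation.Unary using (Pred)
open import Function.Bundles using (_⇔_)
open import Level using (0ℓ)

-- A (simple) graph G with an edge-colouring c.  The colouring is given as a
-- symmetric function on pairs of vertices; only its values on edges matter.
record ColouredGraph : Set₁ where
  field
    V        : Set
    Col      : Set
    E        : V → V → Set
    E-sym    : ∀ {u v} → E u v → E v u
    E-irrefl : ∀ {u} → ¬ E u u
    c        : V → V → Col
    c-sym    : ∀ u v → c u v ≡ c v u

module _ (G : ColouredGraph) where
  open ColouredGraph G

  EdgeList : Set
  EdgeList = List (V × V)

  verts : EdgeList → List V
  verts = concatMap (λ { (u , v) → u ∷ v ∷ [] })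

  colours : EdgeList → List Col
  colours = map (λ { (u , v) → c u v })

  IsMatching : EdgeList → Set
  IsMatching M = All (λ { (u , v) → E u v }) M × Unique (verts M)

  IsRainbow : EdgeList → Set
  IsRainbow M = Unique (colours M)

  IsRainbowMatchingIn : Pred V 0ℓ → Pred Col 0ℓ → EdgeList → Set
  IsRainbowMatchingIn W C M =
    IsMatching M × IsRainbow M × All W (verts M)
    × (∀ k → (k ∈ colours M) ⇔ C k)

  IsAdapter : Pred Col 0ℓ → ℕ → Pred V 0ℓ → Set
  IsAdapter C ℓ W =
    Σ[ Ms ∈ (Fin ℓ → EdgeList) ]
      ((∀ i → IsRainbowMatchingIn W C (Ms i))
       × (∀ w → W w → Σ[ i ∈ Fin ℓ ] ¬ (w ∈ verts (Ms i))))

maxOver : ∀ {p} → (Fin p → ℕ) → ℕ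
maxOver {zero}  f = 0
maxOver {suc p} f = f zero ⊔ maxOver (λ j → f (suc j))

open import Data.Sum using (_⊎_; inj₁; inj₂)
open import Data.Unit using (⊤; tt)

vertexFamily : ∀ {V : Set} {ℓ : ℕ} → (x y z : Fin ℓ → V) → V
             → (Fin ℓ ⊎ (Fin ℓ ⊎ (Fin ℓ ⊎ ⊤))) → V
vertexFamily x y z w (inj₁ i)               = x i
vertexFamily x y z w (inj₂ (inj₁ i))        = y i
vertexFamily x y z w (inj₂ (inj₂ (inj₁ i))) = z i
vertexFamily x y z w (inj₂ (inj₂ (inj₂ tt))) = w

module Submission where

-- (ii) glues the matchings of the pieces index by index, reusing matchings
-- cyclically in the adapters with fewer of them; a vertex of W_j avoided by the
-- i-th matching of W_j is avoided by the glued matching with that index.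
-- (iii) prepends the edge xy to every matching of W and adds one more matching,
-- zw together with a matching of W that avoids w.  (i) is (iii) iterated,
-- starting from the trivial (∅,1)-adapter {w}.

open import Defs
open import Data.Nat using (ℕ; zero; suc; _≤_; _⊔_; _%_; NonZero; >-nonZero)
open import Data.Nat.DivMod using (_mod_; m<n⇒m%n≡m)
open import Data.Nat.Properties using (≤-trans; m≤m⊔n; m≤n⊔m; ⊔-identityʳ)
open import Data.Fin using (Fin; zero; suc; toℕ; inject≤)
open import Data.Fin.Properties using (toℕ-injective; toℕ-fromℕ<; toℕ-inject≤; toℕ<n; suc-injective)
open import Data.Product as Product using (_×_; _,_; ∃-syntax; Σ-syntax; proj₁; proj₂)
open import Data.Sum as Sum using (_⊎_; inj₁; inj₂)
open import Data.Sum.Properties using (inj₁-injective; inj₂-injective)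
open import Data.Unit using (⊤; tt)
open import Data.List using ([]; _∷_; _++_)
open import Data.List.Properties using (map-++; concatMap-++)
open import Data.List.Membership.Propositional using (_∈_; _∉_)
open import Data.List.Membership.Propositional.Properties using (∈-++⁻; ∈-++⁺ˡ; ∈-++⁺ʳ)
open import Data.List.Relation.Unary.Any using (here; there)
open import Data.List.Relation.Unary.All as All using (All; []; _∷_)
open import Data.List.Relation.Unary.All.Properties using () renaming (++⁺ to All-++⁺)
open import Data.List.Relation.Unary.AllPairs using ([]; _∷_)
open import Data.List.Relation.Unary.Unique.Propositional using (Unique)
open import Data.List.Relation.Unary.Unique.Propositional.Properties using () renaming (++⁺ to Unique-++⁺)
open import Function using (_∘_; id)
open import Function.Bundles using (mk⇔; Equivalence)
open import Function.Definitions using (Injective)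
open import Relation.Binary.PropositionalEquality using (_≡_; _≢_; refl; sym; trans; cong; subst; module ≡-Reasoning)
open import Relation.Nullary using (¬_)
open import Relation.Unary using (Pred; _∪_; _∩_; ∁; ∅; ｛_｝; ⋃; _⊥_; _⊆_; _≐_)
open import Relation.Unary.Properties using (≐-refl)
open import Level using (0ℓ)

∉-∷ : ∀ {A : Set} {a b : A} {xs} → a ≢ b → a ∉ xs → a ∉ b ∷ xs
∉-∷ a≢b a∉xs (here a≡b)   = a≢b a≡b
∉-∷ a≢b a∉xs (there a∈xs) = a∉xs a∈xs

∉-++ : ∀ {A : Set} {a : A} {xs ys} → a ∉ xs → a ∉ ys → a ∉ xs ++ ys
∉-++ {xs = xs} a∉xs a∉ys = Sum.[ a∉xs , a∉ys ] ∘ ∈-++⁻ xs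

mod-inject≤ : ∀ {ℓ m} .{{_ : NonZero ℓ}} (j : Fin ℓ) (ℓ≤m : ℓ ≤ m) → toℕ (inject≤ j ℓ≤m) mod ℓ ≡ j
mod-inject≤ {ℓ} j ℓ≤m = toℕ-injective (begin
  toℕ (toℕ (inject≤ j ℓ≤m) mod ℓ) ≡⟨ toℕ-fromℕ< _ ⟩
  toℕ (inject≤ j ℓ≤m) % ℓ         ≡⟨ cong (_% ℓ) (toℕ-inject≤ j ℓ≤m) ⟩
  toℕ j % ℓ                       ≡⟨ m<n⇒m%n≡m (toℕ<n j) ⟩
  toℕ j                           ∎)
  where open ≡-Reasoning

maxOver-≥ : ∀ {p} (f : Fin p → ℕ) j → f j ≤ maxOver f
maxOver-≥ f zero    = m≤m⊔n (f zero) _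
maxOver-≥ f (suc j) = ≤-trans (maxOver-≥ (f ∘ suc) j) (m≤n⊔m (f zero) _)

⋃-Fin1 : ∀ {A : Set} {P : Fin 1 → Pred A 0ℓ} → P zero ≐ ⋃ (Fin 1) P
⋃-Fin1 = (zero ,_) , λ { (zero , a) → a }

⋃-suc : ∀ {A : Set} {p} {P : Fin (suc p) → Pred A 0ℓ} → P zero ∪ ⋃ (Fin p) (P ∘ suc) ≐ ⋃ (Fin (suc p)) P
⋃-suc = Sum.[ (zero ,_) , Product.map suc id ]
      , λ { (zero , a) → inj₁ a ; (suc j , a) → inj₂ (j , a) }

Sum-map-injective : ∀ {A B C D : Set} {f : A → C} {g : B → D} →
  Injective _≡_ _≡_ f → Injective _≡_ _≡_ g → Injective _≡_ _≡_ (Sum.map f g)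
Sum-map-injective f-inj g-inj {inj₁ _} {inj₁ _} e = cong inj₁ (f-inj (inj₁-injective e))
Sum-map-injective f-inj g-inj {inj₂ _} {inj₂ _} e = cong inj₂ (g-inj (inj₂-injective e))

Index : ℕ → Set
Index ℓ = Fin ℓ ⊎ (Fin ℓ ⊎ (Fin ℓ ⊎ ⊤))

shift : ∀ {ℓ} → Index ℓ → Index (suc ℓ)
shift = Sum.map suc (Sum.map suc (Sum.map suc id))

shift-injective : ∀ {ℓ} → Injective _≡_ _≡_ (shift {ℓ})
shift-injective = Sum-map-injective suc-injective (Sum-map-injective suc-injective (Sum-map-injective suc-injective id))

shift-avoids-zero : ∀ {ℓ} (t : Index ℓ) →
  inj₁ zero ≢ shift t × inj₂ (inj₁ zero) ≢ shift t × inj₂ (inj₂ (inj₁ zero)) ≢ shift t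
shift-avoids-zero (inj₁ _)               = (λ ()) , (λ ()) , (λ ())
shift-avoids-zero (inj₂ (inj₁ _))        = (λ ()) , (λ ()) , (λ ())
shift-avoids-zero (inj₂ (inj₂ (inj₁ _))) = (λ ()) , (λ ()) , (λ ())
shift-avoids-zero (inj₂ (inj₂ (inj₂ _))) = (λ ()) , (λ ()) , (λ ())

vertexFamily-shift : ∀ {V : Set} {ℓ} (x y z : Fin (suc ℓ) → V) (w : V) (t : Index ℓ) →
  vertexFamily (x ∘ suc) (y ∘ suc) (z ∘ suc) w t ≡ vertexFamily x y z w (shift t)
vertexFamily-shift x y z w (inj₁ _)               = refl
vertexFamily-shift x y z w (inj₂ (inj₁ _))        = refl
vertexFamily-shift x y z w (inj₂ (inj₂ (inj₁ _))) = refl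
vertexFamily-shift x y z w (inj₂ (inj₂ (inj₂ _))) = refl

module _ (G : ColouredGraph) where
  open ColouredGraph G

  private variable
    v : V
    k : Col
    ℓ ℓ₁ ℓ₂ : ℕ
    M N : EdgeList G
    W W′ W₁ W₂ : Pred V 0ℓ
    C C′ C₁ C₂ : Pred Col 0ℓ

  verts-++ : ∀ M N → verts G (M ++ N) ≡ verts G M ++ verts G N
  verts-++ M N = concatMap-++ _ M N

  colours-++ : ∀ M N → colours G (M ++ N) ≡ colours G M ++ colours G N
  colours-++ M N = map-++ _ M N

  verts⊆ : IsRainbowMatchingIn G W C M → v ∈ verts G M → W v
  verts⊆ (_ , _ , inW , _) = All.lookup inW

  ∉-verts : IsRainbowMatchingIn G W C M → ¬ W v → v ∉ verts G M
  ∉-verts μ v∉W = v∉W ∘ verts⊆ μ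

  colours⊆ : IsRainbowMatchingIn G W C M → k ∈ colours G M → C k
  colours⊆ (_ , _ , _ , colours⇔C) = Equivalence.to (colours⇔C _)

  colours⊇ : IsRainbowMatchingIn G W C M → C k → k ∈ colours G M
  colours⊇ (_ , _ , _ , colours⇔C) = Equivalence.from (colours⇔C _)

  IsRainbowMatchingIn-resp : W ⊆ W′ → C ≐ C′ → IsRainbowMatchingIn G W C M → IsRainbowMatchingIn G W′ C′ M
  IsRainbowMatchingIn-resp W⊆W′ (C⊆C′ , C′⊆C) μ@(matching , rainbow , inW , _) =
    matching , rainbow , All.map W⊆W′ inW , λ _ → mk⇔ (C⊆C′ ∘ colours⊆ μ) (colours⊇ μ ∘ C′⊆C)

  IsRainbowMatchingIn-avoiding : v ∉ verts G M → IsRainbowMatchingIn G W C M →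
    IsRainbowMatchingIn G (W ∩ ∁ ｛ v ｝) C M
  IsRainbowMatchingIn-avoiding v∉M (matching , rainbow , inW , colours⇔C) =
    matching , rainbow , All.tabulate (λ u∈M → All.lookup inW u∈M , λ { refl → v∉M u∈M }) , colours⇔C

  edge-isRainbowMatchingIn : ∀ {u v} → E u v → u ≢ v →
    IsRainbowMatchingIn G (｛ u ｝ ∪ ｛ v ｝) ｛ c u v ｝ ((u , v) ∷ [])
  edge-isRainbowMatchingIn uv u≢v =
    (uv ∷ [] , (u≢v ∷ []) ∷ [] ∷ []) , [] ∷ [] , inj₁ refl ∷ inj₂ refl ∷ [] ,
    λ _ → mk⇔ (λ { (here refl) → refl }) (λ { refl → here refl })

  ++-isRainbowMatchingIn : W₁ ⊥ W₂ → C₁ ⊥ C₂ →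
    IsRainbowMatchingIn G W₁ C₁ M → IsRainbowMatchingIn G W₂ C₂ N →
    IsRainbowMatchingIn G (W₁ ∪ W₂) (C₁ ∪ C₂) (M ++ N)
  ++-isRainbowMatchingIn {W₁ = W₁} {W₂ = W₂} {M = M} {N = N} W₁⊥W₂ C₁⊥C₂
    μ@((edges₁ , unique₁) , rainbow₁ , inW₁ , _) ν@((edges₂ , unique₂) , rainbow₂ , inW₂ , _) =
      (All-++⁺ edges₁ edges₂
      , subst Unique (sym (verts-++ M N))
          (Unique-++⁺ unique₁ unique₂ λ (v∈M , v∈N) → W₁⊥W₂ (verts⊆ μ v∈M , verts⊆ ν v∈N)))
    , subst Unique (sym (colours-++ M N))
        (Unique-++⁺ rainbow₁ rainbow₂ λ (k∈M , k∈N) → C₁⊥C₂ (colours⊆ μ k∈M , colours⊆ ν k∈N))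
    , subst (All (W₁ ∪ W₂)) (sym (verts-++ M N)) (All-++⁺ (All.map inj₁ inW₁) (All.map inj₂ inW₂))
    , λ k → mk⇔
        (Sum.map (colours⊆ μ) (colours⊆ ν) ∘ ∈-++⁻ (colours G M) ∘ subst (k ∈_) (colours-++ M N))
        (subst (k ∈_) (sym (colours-++ M N)) ∘ Sum.[ ∈-++⁺ˡ ∘ colours⊇ μ , ∈-++⁺ʳ _ ∘ colours⊇ ν ])

  IsAdapter-resp : C ≐ C′ → W ≐ W′ → IsAdapter G C ℓ W → IsAdapter G C′ ℓ W′
  IsAdapter-resp C≐C′ (W⊆W′ , W′⊆W) (Ms , matchings , avoided) =
    Ms , IsRainbowMatchingIn-resp W⊆W′ C≐C′ ∘ matchings , λ v → avoided v ∘ W′⊆W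

  IsAdapter-∅ : IsAdapter G ∅ 1 W
  IsAdapter-∅ = (λ _ → []) , (λ _ → ([] , []) , [] , [] , λ _ → mk⇔ (λ ()) (λ ())) , λ _ _ → zero , λ ()

  IsAdapter-extend : IsAdapter G C ℓ W → ∀ x y z w →
    ¬ W x → ¬ W y → ¬ W z → x ≢ y → x ≢ z → y ≢ z → W w →
    E x y → E z w → c x y ≡ c z w → ¬ C (c x y) →
    IsAdapter G (C ∪ ｛ c x y ｝) (suc ℓ) (W ∪ (｛ x ｝ ∪ (｛ y ｝ ∪ ｛ z ｝)))
  IsAdapter-extend {C = C} {ℓ = ℓ} {W = W} (Ms , matchings , avoided) x y z w
    x∉W y∉W z∉W x≢y x≢z y≢z w∈W xy zw cxy≡czw cxy∉C = Ms′ , matchings′ , avoided′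
    where
    W⁺ : Pred V 0ℓ
    W⁺ = W ∪ (｛ x ｝ ∪ (｛ y ｝ ∪ ｛ z ｝))

    C⁺ : Pred Col 0ℓ
    C⁺ = C ∪ ｛ c x y ｝

    ∉W⇒≢w : ∀ {v} → ¬ W v → v ≢ w
    ∉W⇒≢w v∉W refl = v∉W w∈W

    i₀ : Fin ℓ
    i₀ = proj₁ (avoided w w∈W)

    Ms′ : Fin (suc ℓ) → EdgeList G
    Ms′ zero    = (z , w) ∷ Ms i₀
    Ms′ (suc i) = (x , y) ∷ Ms i

    matchings′ : ∀ i → IsRainbowMatchingIn G W⁺ C⁺ (Ms′ i)
    matchings′ zero = IsRainbowMatchingIn-resp
      (λ { (inj₁ (inj₁ refl)) → inj₂ (inj₂ (inj₂ refl)) ; (inj₁ (inj₂ refl)) → inj₁ w∈W ; (inj₂ (v∈W , _)) → inj₁ v∈W })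
      ( (λ { (inj₁ refl) → inj₂ cxy≡czw ; (inj₂ Ck) → inj₁ Ck })
      , (λ { (inj₁ Ck) → inj₂ Ck ; (inj₂ refl) → inj₁ (sym cxy≡czw) }))
      (++-isRainbowMatchingIn
        (λ { (inj₁ refl , z∈W , _) → z∉W z∈W ; (inj₂ refl , _ , w≢w) → w≢w refl })
        (λ { (refl , Cczw) → cxy∉C (subst C (sym cxy≡czw) Cczw) })
        (edge-isRainbowMatchingIn zw (∉W⇒≢w z∉W))
        (IsRainbowMatchingIn-avoiding (proj₂ (avoided w w∈W)) (matchings i₀)))
    matchings′ (suc i) = IsRainbowMatchingIn-resp
      (λ { (inj₁ (inj₁ refl)) → inj₂ (inj₁ refl) ; (inj₁ (inj₂ refl)) → inj₂ (inj₂ (inj₁ refl)) ; (inj₂ v∈W) → inj₁ v∈W })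
      (Sum.swap , Sum.swap)
      (++-isRainbowMatchingIn
        (λ { (inj₁ refl , x∈W) → x∉W x∈W ; (inj₂ refl , y∈W) → y∉W y∈W })
        (λ { (refl , Ccxy) → cxy∉C Ccxy })
        (edge-isRainbowMatchingIn xy x≢y)
        (matchings i))

    avoided′ : ∀ v → W⁺ v → Σ[ i ∈ Fin (suc ℓ) ] v ∉ verts G (Ms′ i)
    avoided′ v (inj₁ v∈W) =
      suc (proj₁ (avoided v v∈W)) ,
      ∉-∷ (λ { refl → x∉W v∈W }) (∉-∷ (λ { refl → y∉W v∈W }) (proj₂ (avoided v v∈W)))
    avoided′ _ (inj₂ (inj₁ refl)) =
      zero , ∉-∷ x≢z (∉-∷ (∉W⇒≢w x∉W) (∉-verts (matchings i₀) x∉W))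
    avoided′ _ (inj₂ (inj₂ (inj₁ refl))) =
      zero , ∉-∷ y≢z (∉-∷ (∉W⇒≢w y∉W) (∉-verts (matchings i₀) y∉W))
    avoided′ _ (inj₂ (inj₂ (inj₂ refl))) =
      suc i₀ , ∉-∷ (x≢z ∘ sym) (∉-∷ (y≢z ∘ sym) (∉-verts (matchings i₀) z∉W))

  IsAdapter-∪ : .{{_ : NonZero ℓ₁}} .{{_ : NonZero ℓ₂}} → C₁ ⊥ C₂ → W₁ ⊥ W₂ →
    IsAdapter G C₁ ℓ₁ W₁ → IsAdapter G C₂ ℓ₂ W₂ → IsAdapter G (C₁ ∪ C₂) (ℓ₁ ⊔ ℓ₂) (W₁ ∪ W₂)
  IsAdapter-∪ {ℓ₁ = ℓ₁} {ℓ₂ = ℓ₂} {W₁ = W₁} {W₂ = W₂} C₁⊥C₂ W₁⊥W₂ (Ms₁ , matchings₁ , avoided₁) (Ms₂ , matchings₂ , avoided₂) =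
    Ms , (λ i → ++-isRainbowMatchingIn W₁⊥W₂ C₁⊥C₂ (matchings₁ _) (matchings₂ _)) , avoided
    where
    Ms : Fin (ℓ₁ ⊔ ℓ₂) → EdgeList G
    Ms i = Ms₁ (toℕ i mod ℓ₁) ++ Ms₂ (toℕ i mod ℓ₂)

    avoided : ∀ v → (W₁ ∪ W₂) v → Σ[ i ∈ Fin (ℓ₁ ⊔ ℓ₂) ] v ∉ verts G (Ms i)
    avoided v (inj₁ v∈W₁) with avoided₁ v v∈W₁
    ... | j , v∉M₁j = i , subst (v ∉_) (sym (verts-++ (Ms₁ _) (Ms₂ _)))
            (∉-++ (subst (λ j → v ∉ verts G (Ms₁ j)) (sym (mod-inject≤ j (m≤m⊔n ℓ₁ ℓ₂))) v∉M₁j)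
                  (∉-verts (matchings₂ _) λ v∈W₂ → W₁⊥W₂ (v∈W₁ , v∈W₂)))
      where i = inject≤ j (m≤m⊔n ℓ₁ ℓ₂)
    avoided v (inj₂ v∈W₂) with avoided₂ v v∈W₂
    ... | j , v∉M₂j = i , subst (v ∉_) (sym (verts-++ (Ms₁ _) (Ms₂ _)))
            (∉-++ (∉-verts (matchings₁ _) λ v∈W₁ → W₁⊥W₂ (v∈W₁ , v∈W₂))
                  (subst (λ j → v ∉ verts G (Ms₂ j)) (sym (mod-inject≤ j (m≤n⊔m ℓ₁ ℓ₂))) v∉M₂j))
      where i = inject≤ j (m≤n⊔m ℓ₁ ℓ₂)

  IsAdapter-⋃ : ∀ {p} {ℓs : Fin p → ℕ} {Cs : Fin p → Pred Col 0ℓ} {Ws : Fin p → Pred V 0ℓ} →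
    (∀ j → 1 ≤ ℓs j) → (∀ j j′ → j ≢ j′ → Cs j ⊥ Cs j′) →
    (∀ j → IsAdapter G (Cs j) (ℓs j) (Ws j)) → (∀ j j′ → j ≢ j′ → Ws j ⊥ Ws j′) →
    IsAdapter G (⋃ (Fin p) Cs) (maxOver ℓs) (⋃ (Fin p) Ws)
  IsAdapter-⋃ {zero} _ _ _ _ = (λ ()) , (λ ()) , λ { _ (() , _) }
  -- p = 1 is separate because IsAdapter-∪ needs matchings on both sides.
  IsAdapter-⋃ {suc zero} {ℓs} _ _ adapters _ =
    subst (λ ℓ → IsAdapter G _ ℓ _) (sym (⊔-identityʳ (ℓs zero)))
      (IsAdapter-resp ⋃-Fin1 ⋃-Fin1 (adapters zero))
  IsAdapter-⋃ {suc (suc p)} {ℓs} positive Cs-disjoint adapters Ws-disjoint =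
    IsAdapter-resp ⋃-suc ⋃-suc
      (IsAdapter-∪ {{>-nonZero (positive zero)}} {{>-nonZero (≤-trans (positive (suc zero)) (maxOver-≥ (ℓs ∘ suc) zero))}}
        (λ (k∈C₀ , j , k∈Cⱼ) → Cs-disjoint zero (suc j) (λ ()) (k∈C₀ , k∈Cⱼ))
        (λ (v∈W₀ , j , v∈Wⱼ) → Ws-disjoint zero (suc j) (λ ()) (v∈W₀ , v∈Wⱼ))
        (adapters zero)
        (IsAdapter-⋃ (positive ∘ suc)
          (λ j j′ j≢j′ → Cs-disjoint (suc j) (suc j′) (j≢j′ ∘ suc-injective))
          (adapters ∘ suc)
          (λ j j′ j≢j′ → Ws-disjoint (suc j) (suc j′) (j≢j′ ∘ suc-injective))))

  IsAdapter-vertexFamily : ∀ ℓ (cs : Fin ℓ → Col) → Injective _≡_ _≡_ cs →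
    (x y z : Fin ℓ → V) (w : V) → Injective _≡_ _≡_ (vertexFamily x y z w) →
    (∀ i → E (x i) (y i)) → (∀ i → E (z i) w) →
    (∀ i → c (x i) (y i) ≡ cs i) → (∀ i → c (z i) w ≡ cs i) →
    IsAdapter G (λ k → ∃[ i ] (k ≡ cs i)) (suc ℓ) (λ v → ∃[ t ] (v ≡ vertexFamily x y z w t))
  IsAdapter-vertexFamily zero _ _ _ _ _ _ _ _ _ _ _ =
    IsAdapter-resp ((λ ()) , λ { (() , _) }) ≐-refl IsAdapter-∅
  IsAdapter-vertexFamily (suc ℓ) cs cs-injective x y z w F-injective xy zw cxy czw =
    IsAdapter-resp colours≐ vertices≐
      (IsAdapter-extend
        (IsAdapter-vertexFamily ℓ (cs ∘ suc) (suc-injective ∘ cs-injective) (x ∘ suc) (y ∘ suc) (z ∘ suc) w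
          (λ {s} {t} e → shift-injective (F-injective (trans (sym (F-shift s)) (trans e (F-shift t)))))
          (xy ∘ suc) (zw ∘ suc) (cxy ∘ suc) (czw ∘ suc))
        (x zero) (y zero) (z zero) w
        (fresh (proj₁ ∘ shift-avoids-zero))
        (fresh (proj₁ ∘ proj₂ ∘ shift-avoids-zero))
        (fresh (proj₂ ∘ proj₂ ∘ shift-avoids-zero))
        (distinct {inj₁ zero} {inj₂ (inj₁ zero)} (λ ()))
        (distinct {inj₁ zero} {inj₂ (inj₂ (inj₁ zero))} (λ ()))
        (distinct {inj₂ (inj₁ zero)} {inj₂ (inj₂ (inj₁ zero))} (λ ()))
        (inj₂ (inj₂ (inj₂ tt)) , refl)
        (xy zero) (zw zero) (trans (cxy zero) (sym (czw zero)))
        (λ (i , e) → 0≢1+ (cs-injective (trans (sym (cxy zero)) e))))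
    where
    F : Index (suc ℓ) → V
    F = vertexFamily x y z w

    F-shift : ∀ t → vertexFamily (x ∘ suc) (y ∘ suc) (z ∘ suc) w t ≡ F (shift t)
    F-shift = vertexFamily-shift x y z w

    fresh : ∀ {s} → (∀ t → s ≢ shift t) → ¬ (∃[ t ] (F s ≡ vertexFamily (x ∘ suc) (y ∘ suc) (z ∘ suc) w t))
    fresh s∉shift (t , e) = s∉shift t (F-injective (trans e (F-shift t)))

    distinct : ∀ {s t} → s ≢ t → F s ≢ F t
    distinct s≢t = s≢t ∘ F-injective

    0≢1+ : ∀ {i : Fin ℓ} → zero ≢ suc i
    0≢1+ ()

    colours≐ : (λ k → ∃[ i ] (k ≡ cs (suc i))) ∪ ｛ c (x zero) (y zero) ｝ ≐ (λ k → ∃[ i ] (k ≡ cs i))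
    colours≐ =
        (λ { (inj₁ (i , e)) → suc i , e ; (inj₂ refl) → zero , cxy zero })
      , (λ { (zero , e) → inj₂ (trans (cxy zero) (sym e)) ; (suc i , e) → inj₁ (i , e) })

    vertices≐ : (λ v → ∃[ t ] (v ≡ vertexFamily (x ∘ suc) (y ∘ suc) (z ∘ suc) w t))
                  ∪ (｛ x zero ｝ ∪ (｛ y zero ｝ ∪ ｛ z zero ｝))
              ≐ (λ v → ∃[ t ] (v ≡ vertexFamily x y z w t))
    vertices≐ =
        (λ { (inj₁ (t , e)) → shift t , trans e (F-shift t)
           ; (inj₂ (inj₁ refl)) → inj₁ zero , refl
           ; (inj₂ (inj₂ (inj₁ refl))) → inj₂ (inj₁ zero) , refl
           ; (inj₂ (inj₂ (inj₂ refl))) → inj₂ (inj₂ (inj₁ zero)) , refl })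
      , (λ { (inj₁ zero , e) → inj₂ (inj₁ (sym e))
           ; (inj₁ (suc i) , e) → inj₁ (inj₁ i , e)
           ; (inj₂ (inj₁ zero) , e) → inj₂ (inj₂ (inj₁ (sym e)))
           ; (inj₂ (inj₁ (suc i)) , e) → inj₁ (inj₂ (inj₁ i) , e)
           ; (inj₂ (inj₂ (inj₁ zero)) , e) → inj₂ (inj₂ (inj₂ (sym e)))
           ; (inj₂ (inj₂ (inj₁ (suc i))) , e) → inj₁ (inj₂ (inj₂ (inj₁ i)) , e)
           ; (inj₂ (inj₂ (inj₂ tt)) , e) → inj₁ (inj₂ (inj₂ (inj₂ tt)) , e) })

proposition2p4 : (G : ColouredGraph) → let open ColouredGraph G in
    (∀ (ℓ : ℕ) (cs : Fin ℓ → Col) → Injective _≡_ _≡_ cs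
       → (x y z : Fin ℓ → V) (w : V)
       → Injective _≡_ _≡_ (vertexFamily x y z w)
       → (∀ i → E (x i) (y i)) → (∀ i → E (z i) w)
       → (∀ i → c (x i) (y i) ≡ cs i) → (∀ i → c (z i) w ≡ cs i)
       → IsAdapter G (λ k → ∃[ i ] (k ≡ cs i)) (suc ℓ)
           (λ v → ∃[ t ] (v ≡ vertexFamily x y z w t)))
    ×
    (∀ (p : ℕ) (ℓs : Fin p → ℕ) (Cs : Fin p → Pred Col 0ℓ) (Ws : Fin p → Pred V 0ℓ)
       → (∀ j → 1 ≤ ℓs j)
       → (∀ j j′ → j ≢ j′ → Cs j ⊥ Cs j′)
       → (∀ j → IsAdapter G (Cs j) (ℓs j) (Ws j))
       → (∀ j j′ → j ≢ j′ → Ws j ⊥ Ws j′)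
       → IsAdapter G (⋃ (Fin p) Cs) (maxOver ℓs) (⋃ (Fin p) Ws))
    ×
    (∀ (C : Pred Col 0ℓ) (ℓ : ℕ) (W : Pred V 0ℓ) → IsAdapter G C ℓ W
       → (x y z w : V)
       → ¬ W x → ¬ W y → ¬ W z → x ≢ y → x ≢ z → y ≢ z
       → W w → E x y → E z w → c x y ≡ c z w → ¬ C (c x y)
       → IsAdapter G (C ∪ ｛ c x y ｝) (suc ℓ) (W ∪ (｛ x ｝ ∪ (｛ y ｝ ∪ ｛ z ｝))))
proposition2p4 G =
    IsAdapter-vertexFamily G
  , (λ _ _ _ _ → IsAdapter-⋃ G)
  , (λ _ _ _ → IsAdapter-extend G)
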